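{- Let $m\geqslant 3$, $n\geqslant 3$ be odd integers, $n=2n_0+1$, $n_0^{+}=n_0+1$. Let $X=\{x_{i,j}\}$ be a bicentrally balanced $C_4$-face-magic projective labeling on $\mathcal{P}_{m,n}$ and let $\kappa$ be a permutation of $\{1,\ldots,n_0\}$ with $\kappa(j)\equiv j\pmod 2$ for all $j$. Define $Z=\{z_{i,j}\}$ by $z_{i,j}=x_{i,\kappa(j)}$, $z_{i,n_0^{+}}=x_{i,n_0^{+}}$ and $z_{i,n+1-j}=x_{i,n+1-\kappa(j)}$ for all $1\leqslant i\leqslant m$, $1\leqslant j\leqslant n_0$. Then $Z$ is a bicentrally balanced $C_4$-face-magic projective labeling on $\mathcal{P}_{m,n}$.
   Context: For integers $m,n\geqslant 2$, the projective grid graph $\mathcal{P}_{m,n}$ has vertex set $\{(i,j):1\leqslant i\leqslant m,\ 1\leqslant j\leqslant n\}$ and edges $(i,j)$–$(i,j+1)$ ($j\leqslant n-1$), $(i,n)$–$(m+1-i,1)$, $(i,j)$–$(i+1,j)$ ($i\leqslant m-1$), $(m,j)$–$(1,n+1-j)$, embedded naturally in the projective plane. Its 4-cycle faces are $\{(i,j),(i+1,j),(i,j+1),(i+1,j+1)\}$ ($1\leqslant i\leqslant m-1$, $1\leqslant j\leqslant n-1$), $\{(i,n),(i+1,n),(m+1-i,1),(m-i,1)\}$ ($1\leqslant i\leqslant m-1$), and $\{(m,j),(m,j+1),(1,n+1-j),(1,n-j)\}$ ($1\leqslant j\leqslant n-1$); the other two faces are digons. A $C_4$-face-magic projective labeling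 is a bijection $(i,j)\mapsto x_{i,j}$ onto $\{1,\ldots,mn\}$ such that every 4-cycle face has the same label sum (the $C_4$-face-magic value). For odd $m,n$ let $S(i,j)=\tfrac12 mn+\tfrac32$ if $i+j$ is even and $S(i,j)=\tfrac32 mn+\tfrac32$ if $i+j$ is odd; a $C_4$-face-magic projective labeling with value $2mn+3$ is bicentrally balanced if $x_{i,j}+x_{m+1-i,n+1-j}=S(i,j)$ for all $(i,j)$. -}

module Defs where

open import Data.Nat using (ℕ; zero; suc; _+_; _*_; _∸_; _≤_; _<_; _/_; _%_; _≤?_; _≟_)
open import Data.Product using (_×_; Σ-syntax; ∃-syntax; _,_)
open import Relation.Binary.PropositionalEquality using (_≡_)
open import Relation.Nullary using (yes; no)

-- Labels are given as functions ℕ → ℕ → ℕ using 1-based indices;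
-- only the values at 1 ≤ i ≤ m, 1 ≤ j ≤ n are relevant.
Labeling : Set
Labeling = ℕ → ℕ → ℕ

InRange : ℕ → ℕ → Set
InRange k m = 1 ≤ k × k ≤ m

IsBijectiveLabeling : ℕ → ℕ → Labeling → Set
IsBijectiveLabeling m n x =
  (∀ i j → InRange i m → InRange j n → InRange (x i j) (m * n))
  × (∀ i j i' j' → InRange i m → InRange j n → InRange i' m → InRange j' n →
       x i j ≡ x i' j' → (i ≡ i' × j ≡ j'))
  × (∀ k → InRange k (m * n) → Σ[ i ∈ ℕ ] Σ[ j ∈ ℕ ] (InRange i m × InRange j n × x i j ≡ k))

FacesHaveSum : ℕ → ℕ → Labeling → ℕ → Set
FacesHaveSum m n x v =
  (∀ i j → InRange i (m ∸ 1) → InRange j (n ∸ 1) →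
     x i j + x (suc i) j + x i (suc j) + x (suc i) (suc j) ≡ v)
  × (∀ i → InRange i (m ∸ 1) →
     x i n + x (suc i) n + x (m + 1 ∸ i) 1 + x (m ∸ i) 1 ≡ v)
  × (∀ j → InRange j (n ∸ 1) →
     x m j + x m (suc j) + x 1 (n + 1 ∸ j) + x 1 (n ∸ j) ≡ v)

IsC4FaceMagicProjective : ℕ → ℕ → Labeling → ℕ → Set
IsC4FaceMagicProjective m n x v = IsBijectiveLabeling m n x × FacesHaveSum m n x v

-- S(i,j) for odd m, n  (mn odd, so the divisions are exact)
S : ℕ → ℕ → ℕ → ℕ → ℕ
S m n i j with (i + j) % 2 ≟ 0
... | yes _ = (m * n + 3) / 2
... | no  _ = (3 * (m * n) + 3) / 2

IsBicentrallyBalanced : ℕ → ℕ → Labeling → Set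
IsBicentrallyBalanced m n x =
  IsC4FaceMagicProjective m n x (2 * (m * n) + 3)
  × (∀ i j → InRange i m → InRange j n →
       x i j + x (m + 1 ∸ i) (n + 1 ∸ j) ≡ S m n i j)

IsPermutation : ℕ → (ℕ → ℕ) → Set
IsPermutation n0 κ =
  (∀ j → InRange j n0 → InRange (κ j) n0)
  × (∀ j j' → InRange j n0 → InRange j' n0 → κ j ≡ κ j' → j ≡ j')
  × (∀ k → InRange k n0 → ∃[ j ] (InRange j n0 × κ j ≡ k))

-- the labeling Z built from X and κ (n = 2 n0 + 1):
--   z i j = x i (κ j)                (1 ≤ j ≤ n0)
--   z i (n0+1) = x i (n0+1)
--   z i (n+1-j) = x i (n+1-κ j)      (1 ≤ j ≤ n0), i.e. for j' ≥ n0+2,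
--   z i j' = x i (n+1-κ(n+1-j'))
permuteColumns : ℕ → ℕ → (ℕ → ℕ) → Labeling → Labeling
permuteColumns n n0 κ x i j with j ≤? n0
... | yes _ = x i (κ j)
... | no _ with j ≟ suc n0
...   | yes _ = x i j
...   | no _  = x i (n + 1 ∸ κ (n + 1 ∸ j))

-- Z is X with its columns permuted by σ, where σ acts as κ on the left half, fixes the
-- middle column and acts as the reflection-conjugate of κ on the right half. Such a σ
-- preserves parity and commutes with the reflection j ↦ n+1−j, and this is all that is
-- needed. Balancedness is preserved since S only depends on the parity of i + j. In a
-- magic labeling the vertical pairs p(a) = x(i,a) + x(i+1,a) satisfy p(a) + p(a+1) = 2mn+3,
-- so p(a) only depends on the parity of a, which σ preserves; this gives the interior
-- faces. Each face across the twisted edges splits into two antipodal pairs whose S-values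
-- are the two different ones, so these faces follow from balancedness alone.
module Submission where

open import Defs
open import Data.Nat using (ℕ; zero; suc; _+_; _*_; _∸_; _≤_; _<_; _%_; _/_; _≤?_; _≟_; z≤n; s≤s; NonZero)
open import Data.Nat.Properties
open import Data.Nat.DivMod
open import Data.Nat.Divisibility using (_∣_; divides; ∣-refl)
open import Data.Nat.Tactic.RingSolver using (solve-∀)
open import Data.Product using (_×_; _,_; proj₁; proj₂; Σ-syntax)
open import Data.Empty using (⊥-elim)
open import Relation.Nullary using (yes; no)
open import Relation.Binary.Definitions using (tri<; tri≈; tri>)
open import Relation.Binary.PropositionalEquality
open ≡-Reasoning

≤-complement : ∀ {a b c d} → a + b ≡ c + d → b ≤ d → c ≤ a
≤-complement {a} {b} {c} {d} eq b≤d =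
  +-cancelʳ-≤ d c a (subst (_≤ a + d) eq (+-monoʳ-≤ a b≤d))

inRange-∸1⇒< : ∀ {a k} → InRange a (k ∸ 1) → a < k
inRange-∸1⇒< {k = zero}  (s≤s z≤n , ())
inRange-∸1⇒< {k = suc k} (_ , a≤k) = s≤s a≤k

<⇒≤∸1 : ∀ {a k} → a < k → a ≤ k ∸ 1
<⇒≤∸1 (s≤s a≤k) = a≤k

odd⇒≥1 : ∀ {a} → a % 2 ≡ 1 → 1 ≤ a
odd⇒≥1 {zero}  ()
odd⇒≥1 {suc a} _ = s≤s z≤n

%2-suc-suc : ∀ a → suc (suc a) % 2 ≡ a % 2
%2-suc-suc a = %-remove-+ˡ a ∣-refl

suc-%2-≢ : ∀ a → suc a % 2 ≢ a % 2
suc-%2-≢ 0 ()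
suc-%2-≢ 1 ()
suc-%2-≢ (suc (suc a)) rewrite %2-suc-suc (suc a) | %2-suc-suc a = suc-%2-≢ a

%2≢0⇒≡1 : ∀ a → a % 2 ≢ 0 → a % 2 ≡ 1
%2≢0⇒≡1 a a≢0 with a % 2 | m%n<n a 2
... | 0           | _ = ⊥-elim (a≢0 refl)
... | 1           | _ = refl
... | suc (suc _) | s≤s (s≤s ())

+-%-congˡ : ∀ a {b c d} .{{_ : NonZero d}} → b % d ≡ c % d → (a + b) % d ≡ (a + c) % d
+-%-congˡ a {b} {c} {d} eq = begin
  (a + b) % d            ≡⟨ %-distribˡ-+ a b d ⟩
  (a % d + b % d) % d    ≡⟨ cong (λ k → (a % d + k) % d) eq ⟩
  (a % d + c % d) % d    ≡⟨ %-distribˡ-+ a c d ⟨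
  (a + c) % d            ∎

*-odd : ∀ {a b} → a % 2 ≡ 1 → b % 2 ≡ 1 → (a * b) % 2 ≡ 1
*-odd {a} {b} a-odd b-odd = trans (%-distribˡ-* a b 2) (cong₂ (λ u v → (u * v) % 2) a-odd b-odd)

odd-halves-sum : ∀ {N} → N % 2 ≡ 1 → (N + 3) / 2 + (3 * N + 3) / 2 ≡ 2 * N + 3
odd-halves-sum {N} N-odd = subst P (sym N≡1+2t) (P-odd (N / 2))
  where
  P : ℕ → Set
  P N = (N + 3) / 2 + (3 * N + 3) / 2 ≡ 2 * N + 3

  N≡1+2t : N ≡ 1 + N / 2 * 2
  N≡1+2t = trans (m≡m%n+[m/n]*n N 2) (cong (_+ N / 2 * 2) N-odd)

  small : ∀ t → 1 + t * 2 + 3 ≡ (t + 2) * 2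
  small = solve-∀

  large : ∀ t → 3 * (1 + t * 2) + 3 ≡ (3 * t + 3) * 2
  large = solve-∀

  total : ∀ t → t + 2 + (3 * t + 3) ≡ 2 * (1 + t * 2) + 3
  total = solve-∀

  P-odd : ∀ t → P (1 + t * 2)
  P-odd t = begin
    (1 + t * 2 + 3) / 2 + (3 * (1 + t * 2) + 3) / 2
      ≡⟨ cong₂ _+_ (/-congˡ (small t)) (/-congˡ (large t)) ⟩
    (t + 2) * 2 / 2 + (3 * t + 3) * 2 / 2
      ≡⟨ cong₂ _+_ (m*n/n≡m (t + 2) 2) (m*n/n≡m (3 * t + 3) 2) ⟩
    t + 2 + (3 * t + 3)
      ≡⟨ total t ⟩
    2 * (1 + t * 2) + 3 ∎

S-cong : ∀ {m n i j i′ j′} → (i + j) % 2 ≡ (i′ + j′) % 2 → S m n i j ≡ S m n i′ j′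
S-cong {i = i} {j} {i′} {j′} eq with (i + j) % 2 ≟ 0 | (i′ + j′) % 2 ≟ 0
... | yes _ | yes _ = refl
... | no _  | no _  = refl
... | yes p | no q  = ⊥-elim (q (trans (sym eq) p))
... | no p  | yes q = ⊥-elim (p (trans eq q))

S-complementary : ∀ {m n a b c d} → m % 2 ≡ 1 → n % 2 ≡ 1 → (a + b) % 2 ≢ (c + d) % 2 →
                  S m n a b + S m n c d ≡ 2 * (m * n) + 3
S-complementary {m} {n} {a} {b} {c} {d} m-odd n-odd ≢ with (a + b) % 2 ≟ 0 | (c + d) % 2 ≟ 0
... | yes p | yes q = ⊥-elim (≢ (trans p (sym q)))
... | yes _ | no _  = odd-halves-sum {m * n} (*-odd {m} {n} m-odd n-odd)
... | no _  | yes _ = trans (+-comm ((3 * (m * n) + 3) / 2) ((m * n + 3) / 2))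
                            (odd-halves-sum {m * n} (*-odd {m} {n} m-odd n-odd))
... | no p  | no q  = ⊥-elim (≢ (trans (%2≢0⇒≡1 (a + b) p) (sym (%2≢0⇒≡1 (c + d) q))))

reflect : ℕ → ℕ → ℕ
reflect n j = n + 1 ∸ j

reflect-+ : ∀ {n j} → j ≤ n → reflect n j + j ≡ n + 1
reflect-+ {n} j≤n = m∸n+n≡m (≤-trans j≤n (m≤m+n n 1))

reflect-involutive : ∀ {n j} → j ≤ n → reflect n (reflect n j) ≡ j
reflect-involutive {n} j≤n = m∸[m∸n]≡n (≤-trans j≤n (m≤m+n n 1))

reflect-inRange : ∀ {n j} → InRange j n → InRange (reflect n j) n
reflect-inRange {n} {j} (1≤j , j≤n) =
  ≤-complement (trans (reflect-+ j≤n) (+-comm n 1)) j≤n ,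
  ≤-complement (sym (reflect-+ j≤n)) 1≤j

reflect-∸ : ∀ {n j} → j ≤ n → reflect n j ≡ suc (n ∸ j)
reflect-∸ {n} {j} j≤n = trans (+-∸-comm 1 j≤n) (+-comm (n ∸ j) 1)

reflect-∸-self : ∀ {n j} → j ≤ n → reflect n (n ∸ j) ≡ suc j
reflect-∸-self {n} {j} j≤n = trans (reflect-∸ (m∸n≤m n j)) (cong suc (m∸[m∸n]≡n j≤n))

reflect-suc : ∀ n j → reflect n (suc j) ≡ n ∸ j
reflect-suc n j = trans (sym (∸-+-assoc (n + 1) 1 j)) (cong (_∸ j) (m+n∸n≡m n 1))

reflect-one : ∀ n → reflect n 1 ≡ n
reflect-one n = m+n∸n≡m n 1

reflect-self : ∀ n → reflect n n ≡ 1
reflect-self n = m+n∸m≡n n 1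

reflect-%2 : ∀ {n j} → 2 ∣ n + 1 → j ≤ n → reflect n j % 2 ≡ j % 2
reflect-%2 {n} {j} 2∣n+1 j≤n = begin
  reflect n j % 2                ≡⟨ [m+kn]%n≡m%n (reflect n j) j 2 ⟨
  (reflect n j + j * 2) % 2      ≡⟨ cong (_% 2) (regroup (reflect n j) j) ⟩
  ((reflect n j + j) + j) % 2    ≡⟨ cong (λ k → (k + j) % 2) (reflect-+ j≤n) ⟩
  (n + 1 + j) % 2                ≡⟨ %-remove-+ˡ j 2∣n+1 ⟩
  j % 2                          ∎
  where
  regroup : ∀ r j → r + j * 2 ≡ r + j + j
  regroup = solve-∀

InteriorFacesHaveSum : ℕ → ℕ → Labeling → ℕ → Set
InteriorFacesHaveSum m n x v = ∀ i j → InRange i (m ∸ 1) → InRange j (n ∸ 1) →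
  x i j + x (suc i) j + x i (suc j) + x (suc i) (suc j) ≡ v

TwistedFacesHaveSum : ℕ → ℕ → Labeling → ℕ → Set
TwistedFacesHaveSum m n x v =
  (∀ i → InRange i (m ∸ 1) → x i n + x (suc i) n + x (m + 1 ∸ i) 1 + x (m ∸ i) 1 ≡ v)
  × (∀ j → InRange j (n ∸ 1) → x m j + x m (suc j) + x 1 (n + 1 ∸ j) + x 1 (n ∸ j) ≡ v)

Balanced : ℕ → ℕ → Labeling → Set
Balanced m n x = ∀ i j → InRange i m → InRange j n →
  x i j + x (reflect m i) (reflect n j) ≡ S m n i j

balanced⇒twisted-faces : ∀ {m n y} → m % 2 ≡ 1 → n % 2 ≡ 1 → Balanced m n y →
                         TwistedFacesHaveSum m n y (2 * (m * n) + 3)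
balanced⇒twisted-faces {m} {n} {y} m-odd n-odd balanced = across-rows , across-columns
  where
  opposite : ∀ {i j i′ j′} → InRange i m → InRange j n → reflect m i ≡ i′ → reflect n j ≡ j′ →
             y i j + y i′ j′ ≡ S m n i j
  opposite hi hj refl refl = balanced _ _ hi hj

  regroupˡ : ∀ a b c d → a + b + c + d ≡ (c + a) + (d + b)
  regroupˡ = solve-∀

  regroupʳ : ∀ a b c d → a + b + c + d ≡ (a + c) + (b + d)
  regroupʳ = solve-∀

  1∈n : InRange 1 n
  1∈n = ≤-refl , odd⇒≥1 n-odd

  m∈m : InRange m m
  m∈m = odd⇒≥1 m-odd , ≤-refl

  across-rows : ∀ i → InRange i (m ∸ 1) →
                y i n + y (suc i) n + y (m + 1 ∸ i) 1 + y (m ∸ i) 1 ≡ 2 * (m * n) + 3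
  across-rows i hi = begin
    y i n + y (suc i) n + y (reflect m i) 1 + y (m ∸ i) 1
      ≡⟨ regroupˡ (y i n) (y (suc i) n) (y (reflect m i) 1) (y (m ∸ i) 1) ⟩
    (y (reflect m i) 1 + y i n) + (y (m ∸ i) 1 + y (suc i) n)
      ≡⟨ cong₂ _+_ (opposite (reflect-inRange i∈m) 1∈n (reflect-involutive i≤m) (reflect-one n))
                   (opposite m∸i∈m 1∈n (reflect-∸-self i≤m) (reflect-one n)) ⟩
    S m n (reflect m i) 1 + S m n (m ∸ i) 1
      ≡⟨ S-complementary {a = reflect m i} {1} {m ∸ i} {1} m-odd n-odd parities ⟩
    2 * (m * n) + 3 ∎
    where
    i<m : i < m
    i<m = inRange-∸1⇒< hi
    i≤m : i ≤ m
    i≤m = <⇒≤ i<m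
    i∈m : InRange i m
    i∈m = proj₁ hi , i≤m
    m∸i∈m : InRange (m ∸ i) m
    m∸i∈m = m<n⇒0<n∸m i<m , m∸n≤m m i
    parities : (reflect m i + 1) % 2 ≢ (m ∸ i + 1) % 2
    parities rewrite reflect-∸ i≤m = suc-%2-≢ (m ∸ i + 1)

  across-columns : ∀ j → InRange j (n ∸ 1) →
                   y m j + y m (suc j) + y 1 (n + 1 ∸ j) + y 1 (n ∸ j) ≡ 2 * (m * n) + 3
  across-columns j hj = begin
    y m j + y m (suc j) + y 1 (reflect n j) + y 1 (n ∸ j)
      ≡⟨ regroupʳ (y m j) (y m (suc j)) (y 1 (reflect n j)) (y 1 (n ∸ j)) ⟩
    (y m j + y 1 (reflect n j)) + (y m (suc j) + y 1 (n ∸ j))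
      ≡⟨ cong₂ _+_ (opposite m∈m (proj₁ hj , <⇒≤ j<n) (reflect-self m) refl)
                   (opposite m∈m (s≤s z≤n , j<n) (reflect-self m) (reflect-suc n j)) ⟩
    S m n m j + S m n m (suc j)
      ≡⟨ S-complementary {a = m} {j} {m} {suc j} m-odd n-odd parities ⟩
    2 * (m * n) + 3 ∎
    where
    j<n : j < n
    j<n = inRange-∸1⇒< hj
    parities : (m + j) % 2 ≢ (m + suc j) % 2
    parities rewrite +-suc m j = λ eq → suc-%2-≢ (m + j) (sym eq)

module _ (f : ℕ → ℕ) {n v : ℕ} (consecutive : ∀ a → InRange a (n ∸ 1) → f a + f (suc a) ≡ v) where

  consecutive-periodic : ∀ a → 1 ≤ a → suc (suc a) ≤ n → f (suc (suc a)) ≡ f a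
  consecutive-periodic a 1≤a ssa≤n = +-cancelˡ-≡ (f (suc a)) _ _ (begin
    f (suc a) + f (suc (suc a))   ≡⟨ consecutive (suc a) (s≤s z≤n , <⇒≤∸1 ssa≤n) ⟩
    v                             ≡⟨ consecutive a (1≤a , <⇒≤∸1 (≤-trans (n≤1+n _) ssa≤n)) ⟨
    f a + f (suc a)               ≡⟨ +-comm (f a) (f (suc a)) ⟩
    f (suc a) + f a               ∎)

  -- 2 ∸ a % 2 is the representative 1 or 2 of the parity class of a.
  consecutive-representative : ∀ a → 1 ≤ a → a ≤ n → f a ≡ f (2 ∸ a % 2)
  consecutive-representative 1 _ _ = refl
  consecutive-representative 2 _ _ = refl
  consecutive-representative (suc (suc (suc a))) _ a+3≤n = begin
    f (3 + a)                 ≡⟨ consecutive-periodic (suc a) (s≤s z≤n) a+3≤n ⟩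
    f (suc a)                 ≡⟨ consecutive-representative (suc a) (s≤s z≤n) a+1≤n ⟩
    f (2 ∸ suc a % 2)         ≡⟨ cong (λ k → f (2 ∸ k)) (%2-suc-suc (suc a)) ⟨
    f (2 ∸ (3 + a) % 2)       ∎
    where
    a+1≤n : suc a ≤ n
    a+1≤n = ≤-trans (n≤1+n _) (≤-trans (n≤1+n _) a+3≤n)

  consecutive-parity-invariant : ∀ {a b} → InRange a n → InRange b n → a % 2 ≡ b % 2 → f a ≡ f b
  consecutive-parity-invariant {a} {b} (1≤a , a≤n) (1≤b , b≤n) eq = begin
    f a               ≡⟨ consecutive-representative a 1≤a a≤n ⟩
    f (2 ∸ a % 2)     ≡⟨ cong (λ k → f (2 ∸ k)) eq ⟩
    f (2 ∸ b % 2)     ≡⟨ consecutive-representative b 1≤b b≤n ⟨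
    f b               ∎

verticalPair : Labeling → ℕ → ℕ → ℕ
verticalPair y i a = y i a + y (suc i) a

face≡verticalPairs : ∀ y i j →
  y i j + y (suc i) j + y i (suc j) + y (suc i) (suc j) ≡ verticalPair y i j + verticalPair y i (suc j)
face≡verticalPairs y i j = +-assoc (verticalPair y i j) (y i (suc j)) (y (suc i) (suc j))

module ColumnPermutation {m n : ℕ} (x z : Labeling) (σ : ℕ → ℕ)
                         (z≗x∘σ : ∀ i j → z i j ≡ x i (σ j)) where

  permute-bijective : IsPermutation n σ → IsBijectiveLabeling m n x → IsBijectiveLabeling m n z
  permute-bijective (σ-range , σ-injective , σ-surjective) (x-range , x-injective , x-surjective) =
    z-range , z-injective , z-surjective
    where
    z-range : ∀ i j → InRange i m → InRange j n → InRange (z i j) (m * n)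
    z-range i j hi hj = subst (λ k → InRange k (m * n)) (sym (z≗x∘σ i j)) (x-range i (σ j) hi (σ-range j hj))

    z-injective : ∀ i j i′ j′ → InRange i m → InRange j n → InRange i′ m → InRange j′ n →
                  z i j ≡ z i′ j′ → i ≡ i′ × j ≡ j′
    z-injective i j i′ j′ hi hj hi′ hj′ eq = proj₁ same , σ-injective j j′ hj hj′ (proj₂ same)
      where
      same : i ≡ i′ × σ j ≡ σ j′
      same = x-injective i (σ j) i′ (σ j′) hi (σ-range j hj) hi′ (σ-range j′ hj′)
               (trans (sym (z≗x∘σ i j)) (trans eq (z≗x∘σ i′ j′)))

    z-surjective : ∀ k → InRange k (m * n) → Σ[ i ∈ ℕ ] Σ[ j ∈ ℕ ] (InRange i m × InRange j n × z i j ≡ k)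
    z-surjective k hk with x-surjective k hk
    ... | i , j′ , hi , hj′ , xij′≡k with σ-surjective j′ hj′
    ...   | j , hj , σj≡j′ = i , j , hi , hj , trans (z≗x∘σ i j) (trans (cong (x i) σj≡j′) xij′≡k)

  permute-interior-faces : ∀ {v} → (∀ j → InRange j n → InRange (σ j) n) →
                           (∀ j → InRange j n → σ j % 2 ≡ j % 2) →
                           InteriorFacesHaveSum m n x v → InteriorFacesHaveSum m n z v
  permute-interior-faces {v} σ-range σ-parity faces i j hi hj = begin
    z i j + z (suc i) j + z i (suc j) + z (suc i) (suc j)
      ≡⟨ face≡verticalPairs z i j ⟩
    verticalPair z i j + verticalPair z i (suc j)
      ≡⟨ cong₂ _+_ (permuted-pair j) (permuted-pair (suc j)) ⟩
    verticalPair x i (σ j) + verticalPair x i (σ (suc j))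
      ≡⟨ cong₂ _+_ (pair-parity-invariant j∈n) (pair-parity-invariant j+1∈n) ⟩
    verticalPair x i j + verticalPair x i (suc j)
      ≡⟨ consecutive-pairs j hj ⟩
    v ∎
    where
    j∈n : InRange j n
    j∈n = proj₁ hj , <⇒≤ (inRange-∸1⇒< hj)
    j+1∈n : InRange (suc j) n
    j+1∈n = s≤s z≤n , inRange-∸1⇒< hj

    permuted-pair : ∀ a → verticalPair z i a ≡ verticalPair x i (σ a)
    permuted-pair a = cong₂ _+_ (z≗x∘σ i a) (z≗x∘σ (suc i) a)

    consecutive-pairs : ∀ a → InRange a (n ∸ 1) → verticalPair x i a + verticalPair x i (suc a) ≡ v
    consecutive-pairs a ha = trans (sym (face≡verticalPairs x i a)) (faces i a hi ha)

    pair-parity-invariant : ∀ {a} → InRange a n → verticalPair x i (σ a) ≡ verticalPair x i a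
    pair-parity-invariant {a} ha =
      consecutive-parity-invariant (verticalPair x i) consecutive-pairs (σ-range a ha) ha (σ-parity a ha)

  permute-balanced : (∀ j → InRange j n → InRange (σ j) n) →
                     (∀ j → InRange j n → σ j % 2 ≡ j % 2) →
                     (∀ j → InRange j n → σ (reflect n j) ≡ reflect n (σ j)) →
                     Balanced m n x → Balanced m n z
  permute-balanced σ-range σ-parity σ-reflect balanced i j hi hj = begin
    z i j + z (reflect m i) (reflect n j)
      ≡⟨ cong₂ _+_ (z≗x∘σ i j) (z≗x∘σ (reflect m i) (reflect n j)) ⟩
    x i (σ j) + x (reflect m i) (σ (reflect n j))
      ≡⟨ cong (λ k → x i (σ j) + x (reflect m i) k) (σ-reflect j hj) ⟩
    x i (σ j) + x (reflect m i) (reflect n (σ j))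
      ≡⟨ balanced i (σ j) hi (σ-range j hj) ⟩
    S m n i (σ j)
      ≡⟨ S-cong {i = i} {σ j} {i} {j} (+-%-congˡ i (σ-parity j hj)) ⟩
    S m n i j ∎

extend : ℕ → (ℕ → ℕ) → ℕ → ℕ
extend n0 κ j with j ≤? n0
... | yes _ = κ j
... | no _ with j ≟ suc n0
...   | yes _ = j
...   | no _  = reflect (suc (2 * n0)) (κ (reflect (suc (2 * n0)) j))

permuteColumns≗extend : ∀ n0 κ x i j → permuteColumns (suc (2 * n0)) n0 κ x i j ≡ x i (extend n0 κ j)
permuteColumns≗extend n0 κ x i j with j ≤? n0
... | yes _ = refl
... | no _ with j ≟ suc n0
...   | yes _ = refl
...   | no _  = refl

module ExtendedPermutation (n0 : ℕ) (κ : ℕ → ℕ) (κ-permutation : IsPermutation n0 κ) where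

  n : ℕ
  n = suc (2 * n0)

  σ : ℕ → ℕ
  σ = extend n0 κ

  n+1≡ : n + 1 ≡ suc n0 + suc n0
  n+1≡ = lemma n0
    where
    lemma : ∀ k → suc (2 * k) + 1 ≡ suc k + suc k
    lemma = solve-∀

  n+1≡′ : n + 1 ≡ n0 + suc (suc n0)
  n+1≡′ = trans n+1≡ (sym (+-suc n0 (suc n0)))

  n0≤n : n0 ≤ n
  n0≤n = ≤-complement n+1≡′ (s≤s z≤n)

  n0+1≤n : suc n0 ≤ n
  n0+1≤n = ≤-complement n+1≡ (s≤s z≤n)

  κ-inRange : ∀ j → InRange j n0 → InRange (κ j) n0
  κ-inRange = proj₁ κ-permutation

  κ-inRange-n : ∀ j → InRange j n0 → InRange (κ j) n
  κ-inRange-n j hj = proj₁ (κ-inRange j hj) , ≤-trans (proj₂ (κ-inRange j hj)) n0≤n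

  data Region (j : ℕ) : Set where
    left   : j ≤ n0 → Region j
    middle : j ≡ suc n0 → Region j
    right  : suc (suc n0) ≤ j → Region j

  region : ∀ j → Region j
  region j with <-cmp j (suc n0)
  ... | tri< j<n0+1 _ _ = left (≤-pred j<n0+1)
  ... | tri≈ _ j≡n0+1 _ = middle j≡n0+1
  ... | tri> _ _ n0+1<j = right n0+1<j

  reflect-left : ∀ {j} → j ≤ n0 → suc (suc n0) ≤ reflect n j
  reflect-left {j} j≤n0 =
    ≤-complement (trans (reflect-+ (≤-trans j≤n0 n0≤n)) (trans n+1≡′ (+-comm n0 (suc (suc n0))))) j≤n0

  reflect-right : ∀ {j} → suc (suc n0) ≤ j → j ≤ n → InRange (reflect n j) n0
  reflect-right {j} n0+2≤j j≤n =
    proj₁ (reflect-inRange (≤-trans (s≤s z≤n) n0+2≤j , j≤n)) ,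
    ≤-complement (trans (sym n+1≡′) (sym (reflect-+ j≤n))) n0+2≤j

  reflect-middle : reflect n (suc n0) ≡ suc n0
  reflect-middle = trans (cong (_∸ suc n0) n+1≡) (m+n∸m≡n (suc n0) (suc n0))

  extend-left : ∀ {j} → j ≤ n0 → σ j ≡ κ j
  extend-left {j} j≤n0 with j ≤? n0
  ... | yes _   = refl
  ... | no j≰n0 = ⊥-elim (j≰n0 j≤n0)

  extend-middle : σ (suc n0) ≡ suc n0
  extend-middle with suc n0 ≤? n0
  ... | yes n0+1≤n0 = ⊥-elim (1+n≰n n0+1≤n0)
  ... | no _ with suc n0 ≟ suc n0
  ...   | yes _ = refl
  ...   | no ≢  = ⊥-elim (≢ refl)

  extend-right : ∀ {j} → suc (suc n0) ≤ j → σ j ≡ reflect n (κ (reflect n j))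
  extend-right {j} n0+2≤j with j ≤? n0
  ... | yes j≤n0 = ⊥-elim (1+n≰n (≤-trans (≤-trans (n≤1+n _) n0+2≤j) j≤n0))
  ... | no _ with j ≟ suc n0
  ...   | yes refl = ⊥-elim (1+n≰n n0+2≤j)
  ...   | no _     = refl

  extend-left-≤ : ∀ {j} → InRange j n0 → σ j ≤ n0
  extend-left-≤ {j} hj rewrite extend-left (proj₂ hj) = proj₂ (κ-inRange j hj)

  extend-right-≥ : ∀ {j} → suc (suc n0) ≤ j → j ≤ n → suc (suc n0) ≤ σ j
  extend-right-≥ {j} n0+2≤j j≤n rewrite extend-right n0+2≤j =
    reflect-left (proj₂ (κ-inRange (reflect n j) (reflect-right n0+2≤j j≤n)))

  extend-inRange : ∀ j → InRange j n → InRange (σ j) n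
  extend-inRange j (1≤j , j≤n) with region j
  ... | left j≤n0      rewrite extend-left j≤n0 = κ-inRange-n j (1≤j , j≤n0)
  ... | middle refl    rewrite extend-middle = s≤s z≤n , n0+1≤n
  ... | right n0+2≤j   rewrite extend-right n0+2≤j =
    reflect-inRange (κ-inRange-n (reflect n j) (reflect-right n0+2≤j j≤n))

  extend-parity : (∀ j → InRange j n0 → κ j % 2 ≡ j % 2) → ∀ j → InRange j n → σ j % 2 ≡ j % 2
  extend-parity κ-parity j (1≤j , j≤n) with region j
  ... | left j≤n0     rewrite extend-left j≤n0 = κ-parity j (1≤j , j≤n0)
  ... | middle refl   rewrite extend-middle = refl
  ... | right n0+2≤j  rewrite extend-right n0+2≤j = begin
    reflect n (κ (reflect n j)) % 2  ≡⟨ reflect-%2 2∣n+1 (proj₂ (κ-inRange-n _ rj∈n0)) ⟩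
    κ (reflect n j) % 2              ≡⟨ κ-parity (reflect n j) rj∈n0 ⟩
    reflect n j % 2                  ≡⟨ reflect-%2 2∣n+1 j≤n ⟩
    j % 2                            ∎
    where
    rj∈n0 : InRange (reflect n j) n0
    rj∈n0 = reflect-right n0+2≤j j≤n
    2∣n+1 : 2 ∣ n + 1
    2∣n+1 = divides (suc n0) (trans n+1≡ (solve-double (suc n0)))
      where
      solve-double : ∀ k → k + k ≡ k * 2
      solve-double = solve-∀

  extend-reflect : ∀ j → InRange j n → σ (reflect n j) ≡ reflect n (σ j)
  extend-reflect j (1≤j , j≤n) with region j
  ... | left j≤n0 = begin
    σ (reflect n j)                            ≡⟨ extend-right (reflect-left j≤n0) ⟩
    reflect n (κ (reflect n (reflect n j)))    ≡⟨ cong (λ k → reflect n (κ k)) (reflect-involutive j≤n) ⟩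
    reflect n (κ j)                            ≡⟨ cong (reflect n) (extend-left j≤n0) ⟨
    reflect n (σ j)                            ∎
  ... | middle refl = begin
    σ (reflect n (suc n0))    ≡⟨ cong σ reflect-middle ⟩
    σ (suc n0)                ≡⟨ extend-middle ⟩
    suc n0                    ≡⟨ reflect-middle ⟨
    reflect n (suc n0)        ≡⟨ cong (reflect n) extend-middle ⟨
    reflect n (σ (suc n0))    ∎
  ... | right n0+2≤j = begin
    σ (reflect n j)                            ≡⟨ extend-left (proj₂ (reflect-right n0+2≤j j≤n)) ⟩
    κ (reflect n j)                            ≡⟨ reflect-involutive κrj≤n ⟨
    reflect n (reflect n (κ (reflect n j)))    ≡⟨ cong (reflect n) (extend-right n0+2≤j) ⟨
    reflect n (σ j)                            ∎
    where
    κrj≤n : κ (reflect n j) ≤ n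
    κrj≤n = proj₂ (κ-inRange-n (reflect n j) (reflect-right n0+2≤j j≤n))

  extend-reflects-left : ∀ {j} → InRange j n → σ j ≤ n0 → j ≤ n0
  extend-reflects-left {j} (1≤j , j≤n) σj≤n0 with region j
  ... | left j≤n0    = j≤n0
  ... | middle refl  = ⊥-elim (1+n≰n (subst (_≤ n0) extend-middle σj≤n0))
  ... | right n0+2≤j = ⊥-elim (1+n≰n (≤-trans (≤-trans (n≤1+n _) (extend-right-≥ n0+2≤j j≤n)) σj≤n0))

  extend-reflects-middle : ∀ {j} → InRange j n → σ j ≡ suc n0 → j ≡ suc n0
  extend-reflects-middle {j} (1≤j , j≤n) σj≡n0+1 with region j
  ... | left j≤n0    = ⊥-elim (1+n≰n (subst (_≤ n0) σj≡n0+1 (extend-left-≤ (1≤j , j≤n0))))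
  ... | middle j≡n0+1 = j≡n0+1
  ... | right n0+2≤j = ⊥-elim (1+n≰n (subst (suc (suc n0) ≤_) σj≡n0+1 (extend-right-≥ n0+2≤j j≤n)))

  extend-injective-left : ∀ {j j′} → InRange j n0 → InRange j′ n → σ j ≡ σ j′ → j ≡ j′
  extend-injective-left {j} {j′} hj hj′ σj≡σj′ =
    proj₁ (proj₂ κ-permutation) j j′ hj j′∈n0
      (trans (sym (extend-left (proj₂ hj))) (trans σj≡σj′ (extend-left (proj₂ j′∈n0))))
    where
    j′∈n0 : InRange j′ n0
    j′∈n0 = proj₁ hj′ , extend-reflects-left hj′ (subst (_≤ n0) σj≡σj′ (extend-left-≤ hj))

  -- The right half is reduced to the left half by conjugating with the reflection.
  extend-injective : ∀ j j′ → InRange j n → InRange j′ n → σ j ≡ σ j′ → j ≡ j′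
  extend-injective j j′ (1≤j , j≤n) hj′ σj≡σj′ with region j
  ... | left j≤n0    = extend-injective-left (1≤j , j≤n0) hj′ σj≡σj′
  ... | middle refl  = sym (extend-reflects-middle hj′ (trans (sym σj≡σj′) extend-middle))
  ... | right n0+2≤j = begin
    j                            ≡⟨ reflect-involutive j≤n ⟨
    reflect n (reflect n j)      ≡⟨ cong (reflect n) reflected ⟩
    reflect n (reflect n j′)     ≡⟨ reflect-involutive (proj₂ hj′) ⟩
    j′                           ∎
    where
    reflected : reflect n j ≡ reflect n j′
    reflected = extend-injective-left (reflect-right n0+2≤j j≤n) (reflect-inRange hj′) (begin
      σ (reflect n j)      ≡⟨ extend-reflect j (1≤j , j≤n) ⟩
      reflect n (σ j)      ≡⟨ cong (reflect n) σj≡σj′ ⟩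
      reflect n (σ j′)     ≡⟨ extend-reflect j′ hj′ ⟨
      σ (reflect n j′)     ∎)

  extend-surjective : ∀ k → InRange k n → Σ[ j ∈ ℕ ] (InRange j n × σ j ≡ k)
  extend-surjective k (1≤k , k≤n) with region k
  ... | left k≤n0 with proj₂ (proj₂ κ-permutation) k (1≤k , k≤n0)
  ...   | j , (1≤j , j≤n0) , κj≡k = j , (1≤j , ≤-trans j≤n0 n0≤n) , trans (extend-left j≤n0) κj≡k
  extend-surjective k _ | middle refl = suc n0 , (s≤s z≤n , n0+1≤n) , extend-middle
  extend-surjective k (1≤k , k≤n) | right n0+2≤k
    with proj₂ (proj₂ κ-permutation) (reflect n k) (reflect-right n0+2≤k k≤n)
  ... | j , (1≤j , j≤n0) , κj≡rk = reflect n j , reflect-inRange j∈n , (begin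
    σ (reflect n j)      ≡⟨ extend-reflect j j∈n ⟩
    reflect n (σ j)      ≡⟨ cong (reflect n) (trans (extend-left j≤n0) κj≡rk) ⟩
    reflect n (reflect n k) ≡⟨ reflect-involutive k≤n ⟩
    k                    ∎)
    where
    j∈n : InRange j n
    j∈n = 1≤j , ≤-trans j≤n0 n0≤n

  extend-isPermutation : IsPermutation n σ
  extend-isPermutation = extend-inRange , extend-injective , extend-surjective

lemma22 : (m n n0 : ℕ) → 3 ≤ m → 3 ≤ n → m % 2 ≡ 1 → n % 2 ≡ 1 →
          n ≡ suc (2 * n0) →
          (x : Labeling) → IsBicentrallyBalanced m n x →
          (κ : ℕ → ℕ) → IsPermutation n0 κ →
          (∀ j → InRange j n0 → κ j % 2 ≡ j % 2) →
          IsBicentrallyBalanced m n (permuteColumns n n0 κ x)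
lemma22 m .(suc (2 * n0)) n0 _ _ m-odd n-odd refl x ((x-bijective , x-interior , _) , x-balanced)
        κ κ-permutation κ-parity =
  (permute-bijective extend-isPermutation x-bijective ,
   permute-interior-faces extend-inRange σ-parity x-interior ,
   balanced⇒twisted-faces {m} {n} {permuteColumns n n0 κ x} m-odd n-odd z-balanced) ,
  z-balanced
  where
  open ExtendedPermutation n0 κ κ-permutation
  open ColumnPermutation {m} {n} x (permuteColumns n n0 κ x) σ (permuteColumns≗extend n0 κ x)

  σ-parity : ∀ j → InRange j n → σ j % 2 ≡ j % 2
  σ-parity = extend-parity κ-parity

  z-balanced : Balanced m n (permuteColumns n n0 κ x)
  z-balanced = permute-balanced extend-inRange σ-parity extend-reflect x-balanced
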